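{- There exist $4$-GDDs of types $2^{21} 5^4$, $2^{24} 5^4$, $2^{27} 5^4$, $2^{33} 5^4$, $2^{32} 5^5$ and $2^{35} 5^5$.
   Context: A $4$-GDD is a triple $(X,\mathcal{G},\mathcal{B})$ where $X$ is a finite point set, $\mathcal{G}$ a partition of $X$ into groups, and $\mathcal{B}$ a collection of $4$-element subsets (blocks) such that no block meets a group in more than one point and any two points from distinct groups lie in exactly one common block. Type $2^t5^s$ means $t$ groups of size $2$ and $s$ groups of size $5$. -}

module Defs where

open import Data.Nat using (ℕ; _<?_)
open import Data.Fin using (Fin; toℕ; _≟_)
open import Data.List using (List; length; filter; allFin)
open import Data.List.Membership.Propositional using (_∈_)
open import Data.Vec using (Vec; lookup)
import Data.Vec.Membership.DecPropositional as VM
open import Relation.Nullary.Decidable using (_×-dec_; does)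
open import Relation.Binary.PropositionalEquality using (_≡_; _≢_)
open import Data.Bool using (if_then_else_)

-- Points are Fin v; grp assigns each point its group, so the
-- groups form a partition of the point set.  Blocks are 4-tuples of points;
-- the transversality condition (distinct positions lie in distinct groups)
-- forces the 4 entries to be distinct, so each block is a 4-element subset.
record GDD4 (n : ℕ) (size : Fin n → ℕ) : Set where
  field
    v       : ℕ
    grp     : Fin v → Fin n
    grpSize : ∀ k → length (filter (λ x → grp x ≟ k) (allFin v)) ≡ size k
    blocks  : List (Vec (Fin v) 4)
    transversal : ∀ B → B ∈ blocks → ∀ i j → i ≢ j →
                  grp (lookup B i) ≢ grp (lookup B j)
    pairCover : ∀ x y → grp x ≢ grp y →
                length (filter (λ B → (VM._∈?_ (_≟_ {v}) x B) ×-dec (VM._∈?_ (_≟_ {v}) y B)) blocks) ≡ 1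

type25 : (t s : ℕ) → Fin (t Data.Nat.+ s) → ℕ
type25 t s k = if does (toℕ k <? t) then 2 else 5

-- The GDD axioms are decidable for a finite structure, so each design is
-- exhibited and verified by evaluation.  The designs of types 2²¹5⁴, 2²⁴5⁴,
-- 2²⁷5⁴ and 2³⁵5⁵ admit an automorphism σ of order 20, 16, 20 and 5
-- respectively, and are given by base blocks, one from each σ-orbit of blocks;
-- those of types 2³³5⁴ and 2³²5⁵ are listed in full.

module Submission where

open import Defs
open import Data.Bool using (true; false; _∨_; if_then_else_)
open import Data.Fin using (Fin; toℕ; _≟_)
open import Data.Fin.Properties using (all?; toℕ-injective)
open import Data.List using (List; []; _∷_; length; filter; allFin; map; upTo; concatMap)
open import Data.List.Properties using (length-map)
open import Data.List.Relation.Unary.All as All using (All)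
open import Data.Nat using (ℕ; zero; suc; _+_; _*_; _∸_; _<ᵇ_; _/_; _%_; NonZero)
open import Data.Nat.DivMod using (_mod_)
import Data.Nat.Properties as ℕ
open import Data.Product using (_×_; _,_)
open import Data.Vec using (Vec; []; _∷_; lookup)
import Data.Vec as Vec
import Data.Vec.Membership.DecPropositional as VecMembership
open import Function using (_∘_; Injective)
open import Function.Bundles using (mk⇔)
open import Relation.Binary.Definitions using (DecidableEquality)
open import Relation.Binary.PropositionalEquality using (_≡_; _≢_; refl; cong; cong₂; trans; module ≡-Reasoning)
open import Relation.Nullary using (Dec; does)
open import Relation.Nullary.Decidable using (True; toWitness; does-⇔; ¬?; _×-dec_; _→-dec_)
open import Relation.Unary using (Pred; Decidable)

filter-×-dec : ∀ {a p q} {A : Set a} {P : Pred A p} {Q : Pred A q}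
               (P? : Decidable P) (Q? : Decidable Q) (xs : List A) →
               filter (λ x → P? x ×-dec Q? x) xs ≡ filter Q? (filter P? xs)
filter-×-dec P? Q? []       = refl
filter-×-dec P? Q? (x ∷ xs) with does (P? x)
... | false = filter-×-dec P? Q? xs
... | true with does (Q? x)
...   | false = filter-×-dec P? Q? xs
...   | true  = cong (x ∷_) (filter-×-dec P? Q? xs)

module _ {a b} {A : Set a} {B : Set b} (_≟ᴬ_ : DecidableEquality A) (_≟ᴮ_ : DecidableEquality B)
         {f : A → B} (f-injective : Injective _≡_ _≡_ f) where

  open VecMembership _≟ᴬ_ using () renaming (_∈?_ to _∈ᴬ?_)
  open VecMembership _≟ᴮ_ using () renaming (_∈?_ to _∈ᴮ?_)

  does-∈?-map : ∀ x {m} (xs : Vec A m) → does (f x ∈ᴮ? Vec.map f xs) ≡ does (x ∈ᴬ? xs)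
  does-∈?-map x []       = refl
  does-∈?-map x (y ∷ ys) =
    cong₂ _∨_ (does-⇔ (mk⇔ f-injective (cong f)) (f x ≟ᴮ f y) (x ≟ᴬ y)) (does-∈?-map x ys)

  filter-∈?-map : ∀ x {m} (xss : List (Vec A m)) →
                  filter (f x ∈ᴮ?_) (map (Vec.map f) xss) ≡ map (Vec.map f) (filter (x ∈ᴬ?_) xss)
  filter-∈?-map x []         = refl
  filter-∈?-map x (xs ∷ xss) rewrite does-∈?-map x xs with does (x ∈ᴬ? xs)
  ... | false = filter-∈?-map x xss
  ... | true  = cong (Vec.map f xs ∷_) (filter-∈?-map x xss)

module Certify {n : ℕ} (size : Fin n → ℕ) {v : ℕ} (grp : Fin v → Fin n)
               (blocks : List (Vec (Fin v) 4)) where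

  open VecMembership (_≟_ {v}) using (_∈?_)
  open VecMembership ℕ._≟_ using () renaming (_∈?_ to _∈ᴺ?_)

  GroupSizes : Set
  GroupSizes = ∀ k → length (filter (λ x → grp x ≟ k) (allFin v)) ≡ size k

  Transversal : Vec (Fin v) 4 → Set
  Transversal B = ∀ i j → i ≢ j → grp (lookup B i) ≢ grp (lookup B j)

  through : ℕ → List (Vec ℕ 4) → List (Vec ℕ 4)
  through x = filter (x ∈ᴺ?_)

  CoveredOnceBy : Fin v → List (Vec ℕ 4) → Set
  CoveredOnceBy x blocksˣ = ∀ y → grp x ≢ grp y → length (through (toℕ y) blocksˣ) ≡ 1

  groupSizes? : Dec GroupSizes
  groupSizes? = all? λ k → length (filter (λ x → grp x ≟ k) (allFin v)) ℕ.≟ size k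

  transversal? : ∀ B → Dec (Transversal B)
  transversal? B = all? λ i → all? λ j →
    ¬? (i ≟ j) →-dec ¬? (grp (lookup B i) ≟ grp (lookup B j))

  coveredOnceBy? : ∀ x blocksˣ → Dec (CoveredOnceBy x blocksˣ)
  coveredOnceBy? x blocksˣ = all? λ y →
    ¬? (grp x ≟ grp y) →-dec length (through (toℕ y) blocksˣ) ℕ.≟ 1

  -- The pairs through x are counted among the blocks through x only, and on
  -- ℕ-labels, which keeps evaluation fast; pairCount transfers the result.
  -- The ℕ-labelled blocks are an argument so that evaluation shares them.
  pairCoverIn? : ∀ bs → Dec (∀ x → CoveredOnceBy x (through (toℕ x) bs))
  pairCoverIn? bs = all? λ x → coveredOnceBy? x (through (toℕ x) bs)

  blocksᴺ : List (Vec ℕ 4)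
  blocksᴺ = map (Vec.map toℕ) blocks

  pairCount : ∀ x y → length (filter (λ B → x ∈? B ×-dec y ∈? B) blocks) ≡
                      length (through (toℕ y) (through (toℕ x) blocksᴺ))
  pairCount x y = begin
    length (filter (λ B → x ∈? B ×-dec y ∈? B) blocks)
      ≡⟨ cong length (filter-×-dec (x ∈?_) (y ∈?_) blocks) ⟩
    length (filter (y ∈?_) blocksˣ)
      ≡⟨ length-map (Vec.map toℕ) (filter (y ∈?_) blocksˣ) ⟨
    length (map (Vec.map toℕ) (filter (y ∈?_) blocksˣ))
      ≡⟨ cong length (toℕ-filter-∈? y blocksˣ) ⟨
    length (through (toℕ y) (map (Vec.map toℕ) blocksˣ))
      ≡⟨ cong (length ∘ through (toℕ y)) (toℕ-filter-∈? x blocks) ⟨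
    length (through (toℕ y) (through (toℕ x) blocksᴺ)) ∎
    where
    open ≡-Reasoning
    blocksˣ : List (Vec (Fin v) 4)
    blocksˣ = filter (x ∈?_) blocks
    toℕ-filter-∈? : ∀ z bs → through (toℕ z) (map (Vec.map toℕ) bs) ≡
                             map (Vec.map toℕ) (filter (z ∈?_) bs)
    toℕ-filter-∈? z = filter-∈?-map _≟_ ℕ._≟_ toℕ-injective z

  gdd4 : True groupSizes? → True (All.all? transversal? blocks) → True (pairCoverIn? blocksᴺ) →
         GDD4 n size
  gdd4 sizes transversal cover = record
    { v           = v
    ; grp         = grp
    ; grpSize     = toWitness sizes
    ; blocks      = blocks
    ; transversal = λ B B∈blocks → All.lookup (toWitness transversal) B∈blocks
    ; pairCover   = λ x y x≁y → trans (pairCount x y) (toWitness cover x y x≁y)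
    }

block : ℕ → ℕ → ℕ → ℕ → Vec ℕ 4
block a b c d = a ∷ b ∷ c ∷ d ∷ []

module Certifyᴺ (t s v : ℕ) .{{_ : NonZero (t + s)}} .{{_ : NonZero v}}
                (group : ℕ → ℕ) (blocks : List (Vec ℕ 4)) =
  Certify (type25 t s) (λ x → group (toℕ x) mod (t + s)) (map (Vec.map (_mod v)) blocks)

-- Points are numbered orbit by orbit.  The points of an orbit of length d are
-- x, σx, …, σ^(d-1)x, and σ^j x lies in group firstGroup + j mod period.
data Orbit : Set where
  orbit : (length firstGroup period : ℕ) .{{_ : NonZero length}} .{{_ : NonZero period}} →
          Orbit

fixedPairs : (firstGroup count : ℕ) → List Orbit
fixedPairs g zero    = []
fixedPairs g (suc c) = orbit 1 g 1 ∷ orbit 1 g 1 ∷ fixedPairs (suc g) c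

pointCount : List Orbit → ℕ
pointCount []                 = 0
pointCount (orbit d _ _ ∷ os) = d + pointCount os

groupOf : List Orbit → ℕ → ℕ
groupOf []                 x = 0
groupOf (orbit d g p ∷ os) x = if x <ᵇ d then g + x % p else groupOf os (x ∸ d)

rotate : List Orbit → ℕ → ℕ → ℕ
rotate []                 k x = x
rotate (orbit d _ _ ∷ os) k x = if x <ᵇ d then (x + k) % d else d + rotate os k (x ∸ d)

-- ℓ is the length of the σ-orbit of B, shorter than the order of σ when a
-- proper power of σ fixes B.
develop : List Orbit → List (ℕ × Vec ℕ 4) → List (Vec ℕ 4)
develop os = concatMap λ (ℓ , B) → map (λ k → Vec.map (rotate os k) B) (upTo ℓ)

module CertifyCyclic (t s : ℕ) .{{_ : NonZero (t + s)}}
                     (os : List Orbit) .{{_ : NonZero (pointCount os)}}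
                     (baseBlocks : List (ℕ × Vec ℕ 4)) =
  Certifyᴺ t s (pointCount os) (groupOf os) (develop os baseBlocks)

orbits-2²¹5⁴ : List Orbit
orbits-2²¹5⁴ = orbit 20 0 10 ∷ orbit 20 10 10 ∷ orbit 20 21 4 ∷ fixedPairs 20 1

baseBlocks-2²¹5⁴ : List (ℕ × Vec ℕ 4)
baseBlocks-2²¹5⁴ =
    (20 , block 0 1 27 45)
  ∷ (20 , block 0 2 14 55)
  ∷ (20 , block 0 3 40 46)
  ∷ (20 , block 0 4 13 28)
  ∷ (20 , block 0 5 38 59)
  ∷ (20 , block 0 20 42 61)
  ∷ (20 , block 0 21 47 56)
  ∷ (20 , block 0 22 23 36)
  ∷ (20 , block 0 25 50 52)
  ∷ (20 , block 0 29 32 34)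
  ∷ (20 , block 0 30 39 58)
  ∷ (20 , block 0 31 48 51)
  ∷ (20 , block 0 37 49 60)
  ∷ (20 , block 20 24 53 54)
  ∷ (20 , block 20 28 44 51)
  ∷ (5 , block 40 45 50 55)
  ∷ []

gdd-2²¹5⁴ : GDD4 _ (type25 21 4)
gdd-2²¹5⁴ = CertifyCyclic.gdd4 21 4 orbits-2²¹5⁴ baseBlocks-2²¹5⁴ _ _ _

orbits-2²⁴5⁴ : List Orbit
orbits-2²⁴5⁴ = orbit 16 0 8 ∷ orbit 16 8 8 ∷ orbit 16 16 8 ∷ orbit 16 24 4 ∷ orbit 4 24 4 ∷ []

baseBlocks-2²⁴5⁴ : List (ℕ × Vec ℕ 4)
baseBlocks-2²⁴5⁴ =
    (16 , block 0 1 38 58)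
  ∷ (16 , block 0 2 36 61)
  ∷ (16 , block 0 3 18 22)
  ∷ (16 , block 0 4 51 56)
  ∷ (16 , block 0 5 17 67)
  ∷ (16 , block 0 6 26 50)
  ∷ (16 , block 0 7 30 62)
  ∷ (16 , block 0 16 44 65)
  ∷ (16 , block 0 21 46 64)
  ∷ (16 , block 0 24 41 53)
  ∷ (16 , block 0 25 35 39)
  ∷ (16 , block 0 27 43 49)
  ∷ (16 , block 0 29 40 54)
  ∷ (16 , block 0 32 45 48)
  ∷ (16 , block 0 33 42 47)
  ∷ (16 , block 16 17 30 37)
  ∷ (16 , block 16 21 51 58)
  ∷ (16 , block 16 22 35 50)
  ∷ (16 , block 16 23 38 59)
  ∷ (16 , block 16 34 40 63)
  ∷ (16 , block 16 49 55 64)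
  ∷ (16 , block 32 33 50 64)
  ∷ (16 , block 32 56 58 59)
  ∷ (1 , block 64 65 66 67)
  ∷ []

gdd-2²⁴5⁴ : GDD4 _ (type25 24 4)
gdd-2²⁴5⁴ = CertifyCyclic.gdd4 24 4 orbits-2²⁴5⁴ baseBlocks-2²⁴5⁴ _ _ _

orbits-2²⁷5⁴ : List Orbit
orbits-2²⁷5⁴ = orbit 20 0 10 ∷ orbit 20 10 10 ∷ orbit 20 27 4 ∷ fixedPairs 20 7

baseBlocks-2²⁷5⁴ : List (ℕ × Vec ℕ 4)
baseBlocks-2²⁷5⁴ =
    (20 , block 0 1 5 18)
  ∷ (20 , block 0 6 27 58)
  ∷ (20 , block 0 8 25 41)
  ∷ (20 , block 0 9 39 54)
  ∷ (20 , block 0 20 57 60)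
  ∷ (20 , block 0 22 51 67)
  ∷ (20 , block 0 23 56 66)
  ∷ (20 , block 0 24 49 62)
  ∷ (20 , block 0 26 47 64)
  ∷ (20 , block 0 28 48 63)
  ∷ (20 , block 0 29 43 65)
  ∷ (20 , block 0 31 55 69)
  ∷ (20 , block 0 32 50 61)
  ∷ (20 , block 0 33 59 71)
  ∷ (20 , block 0 34 46 68)
  ∷ (20 , block 0 35 42 70)
  ∷ (20 , block 0 36 44 72)
  ∷ (20 , block 0 38 40 73)
  ∷ (20 , block 20 21 23 35)
  ∷ (20 , block 20 24 33 43)
  ∷ (20 , block 40 41 47 58)
  ∷ (5 , block 40 45 50 55)
  ∷ (1 , block 60 62 69 72)
  ∷ (1 , block 60 63 67 71)
  ∷ (1 , block 60 64 66 73)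
  ∷ (1 , block 60 65 68 70)
  ∷ (1 , block 61 62 66 70)
  ∷ (1 , block 61 63 68 73)
  ∷ (1 , block 61 64 69 71)
  ∷ (1 , block 61 65 67 72)
  ∷ (1 , block 62 64 67 68)
  ∷ (1 , block 62 65 71 73)
  ∷ (1 , block 63 64 70 72)
  ∷ (1 , block 63 65 66 69)
  ∷ (1 , block 66 68 71 72)
  ∷ (1 , block 67 69 70 73)
  ∷ []

gdd-2²⁷5⁴ : GDD4 _ (type25 27 4)
gdd-2²⁷5⁴ = CertifyCyclic.gdd4 27 4 orbits-2²⁷5⁴ baseBlocks-2²⁷5⁴ _ _ _

orbits-2³⁵5⁵ : List Orbit
orbits-2³⁵5⁵ =
  orbit 5 0 5 ∷ orbit 5 0 5 ∷ orbit 5 5 5 ∷ orbit 5 5 5 ∷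
  orbit 5 10 5 ∷ orbit 5 10 5 ∷ orbit 5 15 5 ∷ orbit 5 15 5 ∷
  orbit 5 20 5 ∷ orbit 5 20 5 ∷ orbit 5 25 5 ∷ orbit 5 25 5 ∷
  orbit 5 30 5 ∷ orbit 5 30 5 ∷ orbit 5 35 1 ∷ orbit 5 36 1 ∷
  orbit 5 37 1 ∷ orbit 5 38 1 ∷ orbit 5 39 1 ∷ []

baseBlocks-2³⁵5⁵ : List (ℕ × Vec ℕ 4)
baseBlocks-2³⁵5⁵ =
    (5 , block 0 1 8 18)
  ∷ (5 , block 0 2 13 14)
  ∷ (5 , block 0 6 9 15)
  ∷ (5 , block 0 10 16 19)
  ∷ (5 , block 0 20 24 26)
  ∷ (5 , block 0 21 58 91)
  ∷ (5 , block 0 22 65 79)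
  ∷ (5 , block 0 23 88 90)
  ∷ (5 , block 0 25 32 84)
  ∷ (5 , block 0 27 59 82)
  ∷ (5 , block 0 28 41 76)
  ∷ (5 , block 0 29 47 92)
  ∷ (5 , block 0 30 34 36)
  ∷ (5 , block 0 31 68 71)
  ∷ (5 , block 0 33 70 93)
  ∷ (5 , block 0 35 42 89)
  ∷ (5 , block 0 37 69 87)
  ∷ (5 , block 0 38 51 81)
  ∷ (5 , block 0 39 57 72)
  ∷ (5 , block 0 40 44 46)
  ∷ (5 , block 0 43 73 75)
  ∷ (5 , block 0 45 52 94)
  ∷ (5 , block 0 48 61 86)
  ∷ (5 , block 0 49 67 77)
  ∷ (5 , block 0 50 54 56)
  ∷ (5 , block 0 53 78 80)
  ∷ (5 , block 0 55 62 74)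
  ∷ (5 , block 0 60 64 66)
  ∷ (5 , block 0 63 83 85)
  ∷ (5 , block 5 6 12 14)
  ∷ (5 , block 5 10 17 18)
  ∷ (5 , block 5 20 29 70)
  ∷ (5 , block 5 21 66 67)
  ∷ (5 , block 5 22 53 93)
  ∷ (5 , block 5 23 42 78)
  ∷ (5 , block 5 24 71 84)
  ∷ (5 , block 5 25 58 92)
  ∷ (5 , block 5 26 27 31)
  ∷ (5 , block 5 28 45 77)
  ∷ (5 , block 5 30 39 75)
  ∷ (5 , block 5 32 63 73)
  ∷ (5 , block 5 33 52 83)
  ∷ (5 , block 5 34 76 89)
  ∷ (5 , block 5 35 68 72)
  ∷ (5 , block 5 36 37 41)
  ∷ (5 , block 5 38 55 82)
  ∷ (5 , block 5 40 49 80)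
  ∷ (5 , block 5 43 62 88)
  ∷ (5 , block 5 44 81 94)
  ∷ (5 , block 5 46 47 51)
  ∷ (5 , block 5 48 65 87)
  ∷ (5 , block 5 50 59 85)
  ∷ (5 , block 5 54 74 86)
  ∷ (5 , block 5 56 57 61)
  ∷ (5 , block 5 60 69 90)
  ∷ (5 , block 5 64 79 91)
  ∷ (5 , block 10 20 22 48)
  ∷ (5 , block 10 21 36 44)
  ∷ (5 , block 10 23 47 80)
  ∷ (5 , block 10 24 51 66)
  ∷ (5 , block 10 25 69 74)
  ∷ (5 , block 10 26 34 61)
  ∷ (5 , block 10 27 53 70)
  ∷ (5 , block 10 28 50 52)
  ∷ (5 , block 10 29 35 79)
  ∷ (5 , block 10 30 32 58)
  ∷ (5 , block 10 31 46 54)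
  ∷ (5 , block 10 33 57 85)
  ∷ (5 , block 10 37 63 75)
  ∷ (5 , block 10 38 60 62)
  ∷ (5 , block 10 39 45 84)
  ∷ (5 , block 10 40 42 68)
  ∷ (5 , block 10 41 56 64)
  ∷ (5 , block 10 43 67 90)
  ∷ (5 , block 10 49 55 89)
  ∷ (5 , block 10 59 65 94)
  ∷ (5 , block 10 71 83 92)
  ∷ (5 , block 10 72 76 88)
  ∷ (5 , block 10 73 82 86)
  ∷ (5 , block 10 77 81 93)
  ∷ (5 , block 10 78 87 91)
  ∷ (5 , block 15 20 42 45)
  ∷ (5 , block 15 21 37 56)
  ∷ (5 , block 15 22 25 50)
  ∷ (5 , block 15 23 44 71)
  ∷ (5 , block 15 24 53 86)
  ∷ (5 , block 15 26 41 57)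
  ∷ (5 , block 15 27 46 61)
  ∷ (5 , block 15 28 73 79)
  ∷ (5 , block 15 29 87 90)
  ∷ (5 , block 15 30 52 55)
  ∷ (5 , block 15 31 47 66)
  ∷ (5 , block 15 32 35 60)
  ∷ (5 , block 15 33 54 76)
  ∷ (5 , block 15 34 63 91)
  ∷ (5 , block 15 36 51 67)
  ∷ (5 , block 15 38 78 84)
  ∷ (5 , block 15 39 70 92)
  ∷ (5 , block 15 40 62 65)
  ∷ (5 , block 15 43 64 81)
  ∷ (5 , block 15 48 83 89)
  ∷ (5 , block 15 49 72 75)
  ∷ (5 , block 15 58 88 94)
  ∷ (5 , block 15 59 77 80)
  ∷ (5 , block 15 68 74 93)
  ∷ (5 , block 15 69 82 85)
  ∷ (5 , block 20 30 79 93)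
  ∷ (5 , block 20 31 40 58)
  ∷ (5 , block 20 32 78 83)
  ∷ (5 , block 20 33 69 89)
  ∷ (5 , block 20 34 47 64)
  ∷ (5 , block 20 37 84 94)
  ∷ (5 , block 20 38 50 61)
  ∷ (5 , block 20 39 59 86)
  ∷ (5 , block 20 56 62 81)
  ∷ (5 , block 20 60 74 88)
  ∷ (5 , block 20 63 71 76)
  ∷ (5 , block 25 27 35 86)
  ∷ (5 , block 25 31 44 90)
  ∷ (5 , block 25 37 66 85)
  ∷ (5 , block 25 39 46 94)
  ∷ (5 , block 25 41 55 72)
  ∷ (5 , block 25 42 53 62)
  ∷ (5 , block 25 45 61 82)
  ∷ (5 , block 25 59 68 83)
  ∷ (5 , block 25 63 77 87)
  ∷ (5 , block 25 65 67 81)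
  ∷ (5 , block 30 40 73 84)
  ∷ (5 , block 30 41 50 68)
  ∷ (5 , block 30 42 83 88)
  ∷ (5 , block 30 47 74 89)
  ∷ (5 , block 30 49 69 91)
  ∷ (5 , block 35 37 45 91)
  ∷ (5 , block 35 41 54 70)
  ∷ (5 , block 35 49 56 74)
  ∷ (5 , block 35 51 65 77)
  ∷ (5 , block 40 50 78 89)
  ∷ (5 , block 40 52 88 93)
  ∷ (5 , block 40 57 79 94)
  ∷ (5 , block 45 47 55 71)
  ∷ (5 , block 45 51 64 75)
  ∷ (5 , block 45 59 66 79)
  ∷ (5 , block 50 60 83 94)
  ∷ (5 , block 50 62 73 93)
  ∷ (5 , block 50 67 74 84)
  ∷ (5 , block 55 57 65 76)
  ∷ []

gdd-2³⁵5⁵ : GDD4 _ (type25 35 5)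
gdd-2³⁵5⁵ = CertifyCyclic.gdd4 35 5 orbits-2³⁵5⁵ baseBlocks-2³⁵5⁵ _ _ _

standardGroup : ℕ → ℕ → ℕ
standardGroup t x = if x <ᵇ 2 * t then x / 2 else t + (x ∸ 2 * t) / 5

blocks-2³³5⁴ : List (Vec ℕ 4)
blocks-2³³5⁴ =
    block 0 2 15 16
  ∷ block 0 6 28 34
  ∷ block 0 8 46 50
  ∷ block 0 5 10 12
  ∷ block 0 4 13 14
  ∷ block 0 18 48 64
  ∷ block 0 20 22 30
  ∷ block 0 3 63 69
  ∷ block 0 7 58 68
  ∷ block 0 9 43 67
  ∷ block 0 11 17 21
  ∷ block 0 19 24 66
  ∷ block 0 32 45 73
  ∷ block 0 23 36 70
  ∷ block 0 38 62 72
  ∷ block 0 40 47 74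
  ∷ block 0 37 42 71
  ∷ block 0 26 49 75
  ∷ block 0 25 57 81
  ∷ block 0 29 56 77
  ∷ block 0 31 59 80
  ∷ block 0 33 51 79
  ∷ block 0 35 55 83
  ∷ block 0 39 61 82
  ∷ block 0 41 54 76
  ∷ block 0 27 52 78
  ∷ block 0 44 53 84
  ∷ block 0 60 65 85
  ∷ block 2 6 17 18
  ∷ block 2 8 30 36
  ∷ block 2 10 50 52
  ∷ block 1 2 12 14
  ∷ block 2 20 44 48
  ∷ block 2 4 24 32
  ∷ block 2 7 65 69
  ∷ block 2 9 60 68
  ∷ block 2 11 27 67
  ∷ block 2 5 13 19
  ∷ block 2 21 28 66
  ∷ block 2 22 45 75
  ∷ block 2 34 47 73
  ∷ block 2 25 38 70
  ∷ block 2 40 64 72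
  ∷ block 2 42 51 74
  ∷ block 2 26 39 71
  ∷ block 2 23 54 78
  ∷ block 2 29 59 81
  ∷ block 2 31 58 77
  ∷ block 2 33 61 80
  ∷ block 2 35 53 79
  ∷ block 2 37 57 83
  ∷ block 2 41 63 82
  ∷ block 2 43 56 76
  ∷ block 2 46 55 84
  ∷ block 2 49 62 85
  ∷ block 6 8 19 20
  ∷ block 6 10 32 38
  ∷ block 6 12 52 54
  ∷ block 3 6 14 16
  ∷ block 4 6 44 46
  ∷ block 1 6 15 21
  ∷ block 6 9 49 69
  ∷ block 6 11 62 68
  ∷ block 6 13 23 67
  ∷ block 5 6 30 66
  ∷ block 6 22 41 71
  ∷ block 6 24 47 75
  ∷ block 6 36 51 73
  ∷ block 6 29 40 70
  ∷ block 6 42 48 72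
  ∷ block 6 26 53 74
  ∷ block 6 25 56 78
  ∷ block 6 31 61 81
  ∷ block 6 33 60 77
  ∷ block 6 35 63 80
  ∷ block 6 37 55 79
  ∷ block 6 39 59 83
  ∷ block 6 43 65 82
  ∷ block 6 27 58 76
  ∷ block 6 50 57 84
  ∷ block 6 45 64 85
  ∷ block 4 8 10 21
  ∷ block 8 12 34 40
  ∷ block 8 14 54 56
  ∷ block 7 8 16 18
  ∷ block 1 8 32 66
  ∷ block 3 5 8 17
  ∷ block 8 11 45 69
  ∷ block 8 13 64 68
  ∷ block 8 15 25 67
  ∷ block 8 22 55 74
  ∷ block 8 24 43 71
  ∷ block 8 28 51 75
  ∷ block 8 38 53 73
  ∷ block 8 31 42 70
  ∷ block 8 26 44 72
  ∷ block 8 23 60 76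
  ∷ block 8 29 58 78
  ∷ block 8 33 63 81
  ∷ block 8 35 62 77
  ∷ block 8 37 65 80
  ∷ block 8 39 57 79
  ∷ block 8 41 61 83
  ∷ block 8 27 49 82
  ∷ block 8 52 59 84
  ∷ block 8 47 48 85
  ∷ block 10 14 36 42
  ∷ block 10 16 56 58
  ∷ block 9 10 18 20
  ∷ block 1 7 10 19
  ∷ block 3 10 34 66
  ∷ block 10 13 47 69
  ∷ block 10 15 48 68
  ∷ block 10 17 29 67
  ∷ block 10 22 46 72
  ∷ block 10 24 57 74
  ∷ block 10 27 28 71
  ∷ block 10 30 53 75
  ∷ block 10 40 55 73
  ∷ block 10 26 33 70
  ∷ block 10 23 45 82
  ∷ block 10 25 62 76
  ∷ block 10 31 60 78
  ∷ block 10 35 65 81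
  ∷ block 10 37 64 77
  ∷ block 10 39 49 80
  ∷ block 10 41 59 79
  ∷ block 10 43 63 83
  ∷ block 10 44 51 85
  ∷ block 10 54 61 84
  ∷ block 12 16 26 38
  ∷ block 12 18 58 60
  ∷ block 4 11 12 20
  ∷ block 3 9 12 21
  ∷ block 7 12 36 66
  ∷ block 12 15 51 69
  ∷ block 12 17 44 68
  ∷ block 12 19 31 67
  ∷ block 12 22 35 70
  ∷ block 12 24 50 72
  ∷ block 12 28 59 74
  ∷ block 12 23 30 71
  ∷ block 12 32 55 75
  ∷ block 12 42 57 73
  ∷ block 12 25 47 82
  ∷ block 12 29 64 76
  ∷ block 12 33 62 78
  ∷ block 12 37 49 81
  ∷ block 12 39 48 77
  ∷ block 12 41 45 80
  ∷ block 12 43 61 79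
  ∷ block 12 27 65 83
  ∷ block 12 46 53 85
  ∷ block 12 56 63 84
  ∷ block 14 18 22 40
  ∷ block 14 20 60 62
  ∷ block 5 7 11 14
  ∷ block 9 14 38 66
  ∷ block 14 17 53 69
  ∷ block 14 19 46 68
  ∷ block 14 21 33 67
  ∷ block 14 24 37 70
  ∷ block 14 28 52 72
  ∷ block 14 30 61 74
  ∷ block 14 25 32 71
  ∷ block 14 34 57 75
  ∷ block 14 26 59 73
  ∷ block 14 23 49 83
  ∷ block 14 29 51 82
  ∷ block 14 31 48 76
  ∷ block 14 35 64 78
  ∷ block 14 39 45 81
  ∷ block 14 41 44 77
  ∷ block 14 43 47 80
  ∷ block 14 27 63 79
  ∷ block 14 50 55 85
  ∷ block 14 58 65 84
  ∷ block 16 20 24 42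
  ∷ block 4 16 62 64
  ∷ block 1 9 13 16
  ∷ block 11 16 40 66
  ∷ block 16 19 55 69
  ∷ block 16 21 50 68
  ∷ block 5 16 35 67
  ∷ block 16 22 61 73
  ∷ block 16 28 39 70
  ∷ block 16 30 54 72
  ∷ block 16 32 63 74
  ∷ block 16 29 34 71
  ∷ block 16 36 59 75
  ∷ block 16 23 65 79
  ∷ block 16 25 45 83
  ∷ block 16 31 53 82
  ∷ block 16 33 44 76
  ∷ block 16 37 48 78
  ∷ block 16 41 47 81
  ∷ block 16 43 46 77
  ∷ block 16 27 51 80
  ∷ block 16 52 57 85
  ∷ block 16 49 60 84
  ∷ block 4 18 26 28
  ∷ block 1 18 37 67
  ∷ block 3 11 15 18
  ∷ block 13 18 42 66
  ∷ block 18 21 57 69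
  ∷ block 5 18 52 68
  ∷ block 18 24 63 73
  ∷ block 18 30 41 70
  ∷ block 18 32 56 72
  ∷ block 18 34 65 74
  ∷ block 18 31 36 71
  ∷ block 18 38 61 75
  ∷ block 18 23 53 80
  ∷ block 18 25 49 79
  ∷ block 18 29 47 83
  ∷ block 18 33 55 82
  ∷ block 18 35 46 76
  ∷ block 18 39 44 78
  ∷ block 18 43 51 81
  ∷ block 18 27 50 77
  ∷ block 18 54 59 85
  ∷ block 18 45 62 84
  ∷ block 1 20 54 68
  ∷ block 3 20 39 67
  ∷ block 7 13 17 20
  ∷ block 15 20 26 66
  ∷ block 5 20 59 69
  ∷ block 20 28 65 73
  ∷ block 20 32 43 70
  ∷ block 20 34 58 72
  ∷ block 20 36 49 74
  ∷ block 20 33 38 71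
  ∷ block 20 40 63 75
  ∷ block 20 23 52 77
  ∷ block 20 25 55 80
  ∷ block 20 29 45 79
  ∷ block 20 31 51 83
  ∷ block 20 35 57 82
  ∷ block 20 37 50 76
  ∷ block 20 41 46 78
  ∷ block 20 27 53 81
  ∷ block 20 56 61 85
  ∷ block 20 47 64 84
  ∷ block 1 4 61 69
  ∷ block 3 4 56 68
  ∷ block 4 7 41 67
  ∷ block 4 9 15 19
  ∷ block 4 17 22 66
  ∷ block 4 30 49 73
  ∷ block 4 27 34 70
  ∷ block 4 36 60 72
  ∷ block 4 38 45 74
  ∷ block 4 35 40 71
  ∷ block 4 42 65 75
  ∷ block 4 23 55 81
  ∷ block 4 25 54 77
  ∷ block 4 29 57 80
  ∷ block 4 31 47 79
  ∷ block 4 33 53 83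
  ∷ block 4 37 59 82
  ∷ block 4 39 52 76
  ∷ block 4 43 50 78
  ∷ block 4 58 63 85
  ∷ block 4 48 51 84
  ∷ block 1 3 59 65
  ∷ block 1 11 31 35
  ∷ block 1 17 25 27
  ∷ block 1 5 57 63
  ∷ block 1 22 56 82
  ∷ block 1 24 51 76
  ∷ block 1 28 33 84
  ∷ block 1 30 48 83
  ∷ block 1 34 43 85
  ∷ block 1 36 47 77
  ∷ block 1 38 55 78
  ∷ block 1 40 58 79
  ∷ block 1 42 44 81
  ∷ block 1 26 60 80
  ∷ block 1 23 62 75
  ∷ block 1 29 52 73
  ∷ block 1 39 64 74
  ∷ block 1 41 49 72
  ∷ block 1 45 46 70
  ∷ block 1 50 53 71
  ∷ block 3 7 49 61
  ∷ block 3 13 33 37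
  ∷ block 3 19 23 29
  ∷ block 3 22 62 80
  ∷ block 3 24 58 82
  ∷ block 3 28 53 76
  ∷ block 3 30 35 84
  ∷ block 3 32 44 83
  ∷ block 3 27 36 85
  ∷ block 3 38 51 77
  ∷ block 3 40 57 78
  ∷ block 3 42 60 79
  ∷ block 3 26 46 81
  ∷ block 3 25 64 75
  ∷ block 3 31 54 73
  ∷ block 3 41 48 74
  ∷ block 3 43 45 72
  ∷ block 3 47 50 70
  ∷ block 3 52 55 71
  ∷ block 7 9 45 63
  ∷ block 7 15 35 39
  ∷ block 7 21 25 31
  ∷ block 7 22 50 81
  ∷ block 7 24 64 80
  ∷ block 7 28 60 82
  ∷ block 7 30 55 76
  ∷ block 7 32 37 84
  ∷ block 7 34 46 83
  ∷ block 7 23 38 85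
  ∷ block 7 40 53 77
  ∷ block 7 42 59 78
  ∷ block 7 26 62 79
  ∷ block 7 29 48 75
  ∷ block 7 33 56 73
  ∷ block 7 43 44 74
  ∷ block 7 27 47 72
  ∷ block 7 51 52 70
  ∷ block 7 54 57 71
  ∷ block 9 11 47 65
  ∷ block 9 17 37 41
  ∷ block 5 9 29 33
  ∷ block 9 22 64 79
  ∷ block 9 24 52 81
  ∷ block 9 28 48 80
  ∷ block 9 30 62 82
  ∷ block 9 32 57 76
  ∷ block 9 34 39 84
  ∷ block 9 36 50 83
  ∷ block 9 25 40 85
  ∷ block 9 42 55 77
  ∷ block 9 26 61 78
  ∷ block 9 23 51 72
  ∷ block 9 31 44 75
  ∷ block 9 35 58 73
  ∷ block 9 27 46 74
  ∷ block 9 53 54 70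
  ∷ block 9 56 59 71
  ∷ block 11 13 49 51
  ∷ block 11 19 39 43
  ∷ block 11 22 63 78
  ∷ block 11 24 48 79
  ∷ block 11 28 54 81
  ∷ block 11 30 44 80
  ∷ block 11 32 64 82
  ∷ block 11 34 59 76
  ∷ block 11 36 41 84
  ∷ block 11 38 52 83
  ∷ block 11 29 42 85
  ∷ block 11 26 57 77
  ∷ block 11 23 50 74
  ∷ block 11 25 53 72
  ∷ block 11 33 46 75
  ∷ block 11 37 60 73
  ∷ block 11 55 56 70
  ∷ block 11 58 61 71
  ∷ block 13 15 45 53
  ∷ block 13 21 27 41
  ∷ block 13 22 59 77
  ∷ block 13 24 65 78
  ∷ block 13 28 44 79
  ∷ block 13 30 56 81
  ∷ block 13 32 46 80
  ∷ block 13 34 48 82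
  ∷ block 13 36 61 76
  ∷ block 13 38 43 84
  ∷ block 13 40 54 83
  ∷ block 13 26 31 85
  ∷ block 13 25 52 74
  ∷ block 13 29 55 72
  ∷ block 13 35 50 75
  ∷ block 13 39 62 73
  ∷ block 13 57 58 70
  ∷ block 13 60 63 71
  ∷ block 15 17 47 55
  ∷ block 5 15 23 43
  ∷ block 15 22 33 85
  ∷ block 15 24 61 77
  ∷ block 15 28 49 78
  ∷ block 15 30 46 79
  ∷ block 15 32 58 81
  ∷ block 15 34 50 80
  ∷ block 15 36 44 82
  ∷ block 15 38 63 76
  ∷ block 15 27 40 84
  ∷ block 15 42 56 83
  ∷ block 15 29 54 74
  ∷ block 15 31 57 72
  ∷ block 15 37 52 75
  ∷ block 15 41 64 73
  ∷ block 15 59 60 70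
  ∷ block 15 62 65 71
  ∷ block 17 19 51 57
  ∷ block 17 24 35 85
  ∷ block 17 28 63 77
  ∷ block 17 30 45 78
  ∷ block 17 32 50 79
  ∷ block 17 34 60 81
  ∷ block 17 36 52 80
  ∷ block 17 38 46 82
  ∷ block 17 40 65 76
  ∷ block 17 23 42 84
  ∷ block 17 26 58 83
  ∷ block 17 31 56 74
  ∷ block 17 33 59 72
  ∷ block 17 39 54 75
  ∷ block 17 43 48 73
  ∷ block 17 61 62 70
  ∷ block 17 49 64 71
  ∷ block 19 21 53 59
  ∷ block 19 22 60 83
  ∷ block 19 28 37 85
  ∷ block 19 30 65 77
  ∷ block 19 32 47 78
  ∷ block 19 34 52 79
  ∷ block 19 36 62 81
  ∷ block 19 38 54 80
  ∷ block 19 40 50 82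
  ∷ block 19 42 49 76
  ∷ block 19 25 26 84
  ∷ block 19 33 58 74
  ∷ block 19 35 61 72
  ∷ block 19 41 56 75
  ∷ block 19 27 44 73
  ∷ block 19 63 64 70
  ∷ block 19 45 48 71
  ∷ block 5 21 55 61
  ∷ block 21 22 29 84
  ∷ block 21 24 62 83
  ∷ block 21 30 39 85
  ∷ block 21 32 49 77
  ∷ block 21 34 51 78
  ∷ block 21 36 54 79
  ∷ block 21 38 64 81
  ∷ block 21 40 56 80
  ∷ block 21 42 52 82
  ∷ block 21 26 45 76
  ∷ block 21 23 46 73
  ∷ block 21 35 60 74
  ∷ block 21 37 63 72
  ∷ block 21 43 58 75
  ∷ block 21 44 47 71
  ∷ block 21 48 65 70
  ∷ block 5 22 47 76
  ∷ block 5 24 31 84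
  ∷ block 5 28 64 83
  ∷ block 5 32 41 85
  ∷ block 5 34 45 77
  ∷ block 5 36 53 78
  ∷ block 5 38 56 79
  ∷ block 5 40 48 81
  ∷ block 5 42 58 80
  ∷ block 5 26 54 82
  ∷ block 5 25 50 73
  ∷ block 5 37 62 74
  ∷ block 5 39 65 72
  ∷ block 5 27 60 75
  ∷ block 5 44 49 70
  ∷ block 5 46 51 71
  ∷ block 22 24 34 49
  ∷ block 22 25 28 43
  ∷ block 22 26 32 65
  ∷ block 22 36 38 57
  ∷ block 22 27 39 42
  ∷ block 22 31 52 69
  ∷ block 22 37 51 68
  ∷ block 22 44 54 58
  ∷ block 22 48 53 67
  ∷ block 24 28 36 45
  ∷ block 24 27 29 30
  ∷ block 24 38 40 59
  ∷ block 23 24 26 41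
  ∷ block 24 33 54 69
  ∷ block 24 39 53 68
  ∷ block 24 44 55 67
  ∷ block 24 46 56 60
  ∷ block 28 30 38 47
  ∷ block 23 28 31 32
  ∷ block 28 40 42 61
  ∷ block 28 35 56 69
  ∷ block 28 41 55 68
  ∷ block 28 46 57 67
  ∷ block 28 50 58 62
  ∷ block 30 32 40 51
  ∷ block 25 30 33 34
  ∷ block 26 30 42 63
  ∷ block 30 37 58 69
  ∷ block 30 43 57 68
  ∷ block 30 50 59 67
  ∷ block 30 52 60 64
  ∷ block 32 34 42 53
  ∷ block 29 32 35 36
  ∷ block 32 39 60 69
  ∷ block 27 32 59 68
  ∷ block 32 52 61 67
  ∷ block 32 48 54 62
  ∷ block 26 34 36 55
  ∷ block 31 34 37 38
  ∷ block 23 34 61 68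
  ∷ block 34 41 62 69
  ∷ block 34 44 56 64
  ∷ block 34 54 63 67
  ∷ block 33 36 39 40
  ∷ block 25 36 63 68
  ∷ block 36 43 64 69
  ∷ block 36 46 48 58
  ∷ block 36 56 65 67
  ∷ block 35 38 41 42
  ∷ block 29 38 65 68
  ∷ block 27 38 48 69
  ∷ block 38 44 50 60
  ∷ block 38 49 58 67
  ∷ block 26 37 40 43
  ∷ block 23 40 44 69
  ∷ block 31 40 49 68
  ∷ block 40 46 52 62
  ∷ block 40 45 60 67
  ∷ block 25 42 46 69
  ∷ block 33 42 45 68
  ∷ block 42 50 54 64
  ∷ block 42 47 62 67
  ∷ block 26 29 50 69
  ∷ block 26 35 47 68
  ∷ block 26 48 52 56
  ∷ block 26 51 64 67
  ∷ block 23 25 39 58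
  ∷ block 23 33 35 48
  ∷ block 23 27 37 56
  ∷ block 23 57 64 66
  ∷ block 23 47 59 63
  ∷ block 25 29 41 60
  ∷ block 25 35 37 44
  ∷ block 25 48 59 66
  ∷ block 25 51 61 65
  ∷ block 29 31 43 62
  ∷ block 29 37 39 46
  ∷ block 29 44 61 66
  ∷ block 29 49 53 63
  ∷ block 27 31 33 64
  ∷ block 31 39 41 50
  ∷ block 31 46 63 66
  ∷ block 31 45 55 65
  ∷ block 33 41 43 52
  ∷ block 33 50 65 66
  ∷ block 33 47 49 57
  ∷ block 27 35 43 54
  ∷ block 35 49 52 66
  ∷ block 35 45 51 59
  ∷ block 37 45 54 66
  ∷ block 37 47 53 61
  ∷ block 39 47 56 66
  ∷ block 39 51 55 63
  ∷ block 41 51 58 66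
  ∷ block 41 53 57 65
  ∷ block 43 53 60 66
  ∷ block 43 49 55 59
  ∷ block 27 55 62 66
  ∷ block 27 45 57 61
  ∷ block 44 52 63 65
  ∷ block 44 57 59 62
  ∷ block 46 49 54 65
  ∷ block 46 59 61 64
  ∷ block 45 49 50 56
  ∷ block 48 50 61 63
  ∷ block 45 47 52 58
  ∷ block 47 51 54 60
  ∷ block 51 53 56 62
  ∷ block 53 55 58 64
  ∷ block 48 55 57 60
  ∷ block 66 71 76 81
  ∷ block 66 72 77 83
  ∷ block 66 73 78 85
  ∷ block 66 74 79 82
  ∷ block 66 75 80 84
  ∷ block 67 71 77 82
  ∷ block 67 72 78 84
  ∷ block 67 73 79 81
  ∷ block 67 74 80 83
  ∷ block 67 75 76 85
  ∷ block 68 71 78 83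
  ∷ block 68 72 79 85
  ∷ block 68 73 80 82
  ∷ block 68 74 76 84
  ∷ block 68 75 77 81
  ∷ block 69 71 79 84
  ∷ block 69 72 80 81
  ∷ block 69 73 76 83
  ∷ block 69 74 77 85
  ∷ block 69 75 78 82
  ∷ block 70 71 80 85
  ∷ block 70 72 76 82
  ∷ block 70 73 77 84
  ∷ block 70 74 78 81
  ∷ block 70 75 79 83
  ∷ []

gdd-2³³5⁴ : GDD4 _ (type25 33 4)
gdd-2³³5⁴ = Certifyᴺ.gdd4 33 4 86 (standardGroup 33) blocks-2³³5⁴ _ _ _

blocks-2³²5⁵ : List (Vec ℕ 4)
blocks-2³²5⁵ =
    block 0 2 43 71
  ∷ block 0 24 42 48
  ∷ block 0 22 28 36
  ∷ block 0 32 38 44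
  ∷ block 0 18 40 86
  ∷ block 0 10 46 78
  ∷ block 0 4 77 81
  ∷ block 0 6 25 74
  ∷ block 0 8 26 85
  ∷ block 0 12 17 72
  ∷ block 0 14 75 79
  ∷ block 0 16 20 30
  ∷ block 0 34 41 66
  ∷ block 0 3 57 73
  ∷ block 0 37 60 65
  ∷ block 0 39 59 69
  ∷ block 0 45 52 67
  ∷ block 0 9 19 47
  ∷ block 0 49 54 88
  ∷ block 0 5 11 29
  ∷ block 0 7 56 82
  ∷ block 0 13 55 83
  ∷ block 0 15 50 87
  ∷ block 0 21 63 76
  ∷ block 0 23 61 70
  ∷ block 0 27 51 80
  ∷ block 0 31 62 64
  ∷ block 0 33 53 84
  ∷ block 0 35 58 68
  ∷ block 2 24 45 76
  ∷ block 2 4 36 44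
  ∷ block 2 26 30 38
  ∷ block 2 34 40 46
  ∷ block 2 20 42 67
  ∷ block 2 12 48 83
  ∷ block 2 6 82 86
  ∷ block 2 8 37 79
  ∷ block 2 10 28 66
  ∷ block 2 14 19 77
  ∷ block 2 16 80 84
  ∷ block 2 18 22 32
  ∷ block 1 2 58 73
  ∷ block 2 25 57 78
  ∷ block 2 39 60 70
  ∷ block 2 41 59 74
  ∷ block 2 47 52 72
  ∷ block 2 11 21 49
  ∷ block 2 5 54 64
  ∷ block 2 7 13 31
  ∷ block 2 9 56 87
  ∷ block 2 15 55 88
  ∷ block 2 17 50 68
  ∷ block 2 23 63 81
  ∷ block 2 27 61 75
  ∷ block 2 29 51 85
  ∷ block 2 33 62 69
  ∷ block 2 35 53 65
  ∷ block 24 36 47 81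
  ∷ block 6 24 38 46
  ∷ block 24 28 32 40
  ∷ block 22 24 44 72
  ∷ block 4 14 24 88
  ∷ block 8 24 67 87
  ∷ block 10 24 39 84
  ∷ block 12 24 30 71
  ∷ block 16 21 24 82
  ∷ block 18 24 65 85
  ∷ block 20 24 26 34
  ∷ block 1 24 53 70
  ∷ block 3 24 58 78
  ∷ block 24 37 57 83
  ∷ block 24 41 60 75
  ∷ block 24 43 59 79
  ∷ block 24 49 52 77
  ∷ block 5 13 23 24
  ∷ block 7 24 54 69
  ∷ block 9 15 24 33
  ∷ block 11 24 56 68
  ∷ block 17 24 55 64
  ∷ block 19 24 50 73
  ∷ block 24 27 63 86
  ∷ block 24 29 61 80
  ∷ block 24 31 51 66
  ∷ block 24 35 62 74
  ∷ block 36 38 49 86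
  ∷ block 8 36 40 48
  ∷ block 30 34 36 42
  ∷ block 26 36 46 77
  ∷ block 6 16 36 64
  ∷ block 10 36 68 72
  ∷ block 12 36 41 65
  ∷ block 14 32 36 76
  ∷ block 18 23 36 87
  ∷ block 20 36 66 70
  ∷ block 1 36 62 79
  ∷ block 3 36 53 75
  ∷ block 25 36 58 83
  ∷ block 36 39 57 88
  ∷ block 36 43 60 80
  ∷ block 36 45 59 84
  ∷ block 5 36 52 82
  ∷ block 7 15 27 36
  ∷ block 9 36 54 74
  ∷ block 11 17 35 36
  ∷ block 13 36 56 73
  ∷ block 19 36 55 69
  ∷ block 21 36 50 78
  ∷ block 29 36 63 67
  ∷ block 31 36 61 85
  ∷ block 33 36 51 71
  ∷ block 5 38 40 67
  ∷ block 4 10 38 42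
  ∷ block 28 38 48 82
  ∷ block 8 18 38 69
  ∷ block 12 38 73 77
  ∷ block 14 38 43 70
  ∷ block 16 34 38 81
  ∷ block 20 27 38 68
  ∷ block 22 38 71 75
  ∷ block 1 13 19 38
  ∷ block 3 38 62 84
  ∷ block 25 38 53 80
  ∷ block 37 38 58 88
  ∷ block 38 41 57 64
  ∷ block 38 45 60 85
  ∷ block 38 47 59 65
  ∷ block 7 38 52 87
  ∷ block 9 17 29 38
  ∷ block 11 38 54 79
  ∷ block 15 38 56 78
  ∷ block 21 38 55 74
  ∷ block 23 38 50 83
  ∷ block 31 38 63 72
  ∷ block 33 38 61 66
  ∷ block 35 38 51 76
  ∷ block 7 40 42 72
  ∷ block 6 12 40 44
  ∷ block 4 30 40 87
  ∷ block 10 20 40 74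
  ∷ block 14 40 78 82
  ∷ block 16 40 45 75
  ∷ block 22 29 40 73
  ∷ block 26 40 76 80
  ∷ block 1 40 51 81
  ∷ block 3 15 21 40
  ∷ block 25 40 62 65
  ∷ block 37 40 53 85
  ∷ block 39 40 58 64
  ∷ block 40 43 57 69
  ∷ block 40 47 60 66
  ∷ block 40 49 59 70
  ∷ block 9 40 52 68
  ∷ block 11 19 31 40
  ∷ block 13 40 54 84
  ∷ block 17 40 56 83
  ∷ block 23 40 55 79
  ∷ block 27 40 50 88
  ∷ block 33 40 63 77
  ∷ block 35 40 61 71
  ∷ block 9 42 44 77
  ∷ block 8 14 42 46
  ∷ block 6 32 42 68
  ∷ block 12 22 42 79
  ∷ block 16 42 83 87
  ∷ block 18 42 47 80
  ∷ block 26 31 42 78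
  ∷ block 28 42 81 85
  ∷ block 1 42 61 76
  ∷ block 3 42 51 86
  ∷ block 17 23 25 42
  ∷ block 37 42 62 70
  ∷ block 39 42 53 66
  ∷ block 41 42 58 69
  ∷ block 42 45 57 74
  ∷ block 42 49 60 71
  ∷ block 5 42 59 75
  ∷ block 11 42 52 73
  ∷ block 13 21 33 42
  ∷ block 15 42 54 65
  ∷ block 19 42 56 88
  ∷ block 27 42 55 84
  ∷ block 29 42 50 64
  ∷ block 35 42 63 82
  ∷ block 11 44 46 82
  ∷ block 10 16 44 48
  ∷ block 8 34 44 73
  ∷ block 14 26 44 84
  ∷ block 18 44 68 88
  ∷ block 20 44 49 85
  ∷ block 28 33 44 83
  ∷ block 30 44 66 86
  ∷ block 1 44 63 87
  ∷ block 3 44 61 81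
  ∷ block 25 44 51 67
  ∷ block 19 27 37 44
  ∷ block 39 44 62 75
  ∷ block 41 44 53 71
  ∷ block 43 44 58 74
  ∷ block 44 47 57 79
  ∷ block 5 44 60 76
  ∷ block 7 44 59 80
  ∷ block 13 44 52 78
  ∷ block 15 23 35 44
  ∷ block 17 44 54 70
  ∷ block 21 44 56 64
  ∷ block 29 44 55 65
  ∷ block 31 44 50 69
  ∷ block 13 46 48 87
  ∷ block 4 12 18 46
  ∷ block 16 28 46 65
  ∷ block 20 46 64 73
  ∷ block 5 22 46 66
  ∷ block 30 35 46 88
  ∷ block 32 46 67 71
  ∷ block 1 17 27 46
  ∷ block 3 46 63 68
  ∷ block 25 46 61 86
  ∷ block 37 46 51 72
  ∷ block 21 29 39 46
  ∷ block 41 46 62 80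
  ∷ block 43 46 53 76
  ∷ block 45 46 58 79
  ∷ block 46 49 57 84
  ∷ block 7 46 60 81
  ∷ block 9 46 59 85
  ∷ block 15 46 52 83
  ∷ block 19 46 54 75
  ∷ block 23 46 56 69
  ∷ block 31 46 55 70
  ∷ block 33 46 50 74
  ∷ block 4 15 48 68
  ∷ block 6 14 20 48
  ∷ block 18 30 48 70
  ∷ block 22 48 69 78
  ∷ block 7 26 48 71
  ∷ block 1 32 48 64
  ∷ block 34 48 72 76
  ∷ block 3 19 29 48
  ∷ block 25 48 63 73
  ∷ block 37 48 61 67
  ∷ block 39 48 51 77
  ∷ block 23 31 41 48
  ∷ block 43 48 62 85
  ∷ block 45 48 53 81
  ∷ block 47 48 58 84
  ∷ block 5 48 57 65
  ∷ block 9 48 60 86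
  ∷ block 11 48 59 66
  ∷ block 17 48 52 88
  ∷ block 21 48 54 80
  ∷ block 27 48 56 74
  ∷ block 33 48 55 75
  ∷ block 35 48 50 79
  ∷ block 4 6 17 73
  ∷ block 4 8 16 22
  ∷ block 4 20 32 75
  ∷ block 4 26 74 83
  ∷ block 4 9 28 76
  ∷ block 3 4 34 69
  ∷ block 1 4 50 84
  ∷ block 4 21 25 31
  ∷ block 4 37 63 78
  ∷ block 4 39 61 72
  ∷ block 4 41 51 82
  ∷ block 4 27 33 43
  ∷ block 4 45 62 66
  ∷ block 4 47 53 86
  ∷ block 4 49 58 65
  ∷ block 4 7 57 70
  ∷ block 4 11 60 67
  ∷ block 4 13 59 71
  ∷ block 4 19 52 64
  ∷ block 4 23 54 85
  ∷ block 4 29 56 79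
  ∷ block 4 35 55 80
  ∷ block 6 8 19 78
  ∷ block 6 10 18 26
  ∷ block 6 22 34 80
  ∷ block 6 28 79 88
  ∷ block 6 11 30 81
  ∷ block 1 6 55 85
  ∷ block 3 6 50 65
  ∷ block 6 23 33 37
  ∷ block 6 39 63 83
  ∷ block 6 41 61 77
  ∷ block 6 43 51 87
  ∷ block 6 29 35 45
  ∷ block 6 47 62 71
  ∷ block 6 49 53 67
  ∷ block 5 6 58 70
  ∷ block 6 9 57 75
  ∷ block 6 13 60 72
  ∷ block 6 15 59 76
  ∷ block 6 21 52 69
  ∷ block 6 27 54 66
  ∷ block 6 31 56 84
  ∷ block 8 10 21 83
  ∷ block 8 12 20 28
  ∷ block 8 30 64 84
  ∷ block 8 13 32 86
  ∷ block 1 8 31 47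
  ∷ block 3 8 55 66
  ∷ block 8 25 50 70
  ∷ block 8 27 35 39
  ∷ block 8 41 63 88
  ∷ block 8 43 61 82
  ∷ block 8 45 51 68
  ∷ block 8 49 62 76
  ∷ block 5 8 53 72
  ∷ block 7 8 58 75
  ∷ block 8 11 57 80
  ∷ block 8 15 60 77
  ∷ block 8 17 59 81
  ∷ block 8 23 52 74
  ∷ block 8 29 54 71
  ∷ block 8 33 56 65
  ∷ block 10 12 23 88
  ∷ block 10 14 22 30
  ∷ block 10 32 65 69
  ∷ block 10 15 34 67
  ∷ block 1 10 29 41
  ∷ block 3 10 33 49
  ∷ block 10 25 55 71
  ∷ block 10 37 50 75
  ∷ block 10 43 63 64
  ∷ block 10 45 61 87
  ∷ block 10 47 51 73
  ∷ block 5 10 62 81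
  ∷ block 7 10 53 77
  ∷ block 9 10 58 80
  ∷ block 10 13 57 85
  ∷ block 10 17 60 82
  ∷ block 10 19 59 86
  ∷ block 10 27 52 79
  ∷ block 10 31 54 76
  ∷ block 10 35 56 70
  ∷ block 12 14 27 64
  ∷ block 12 16 26 32
  ∷ block 12 34 70 74
  ∷ block 1 12 56 75
  ∷ block 3 12 31 43
  ∷ block 5 12 25 35
  ∷ block 12 37 55 76
  ∷ block 12 39 50 80
  ∷ block 12 45 63 69
  ∷ block 12 47 61 68
  ∷ block 12 49 51 78
  ∷ block 7 12 62 86
  ∷ block 9 12 53 82
  ∷ block 11 12 58 85
  ∷ block 12 15 57 66
  ∷ block 12 19 60 87
  ∷ block 12 21 59 67
  ∷ block 12 29 52 84
  ∷ block 12 33 54 81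
  ∷ block 14 16 29 69
  ∷ block 14 18 28 34
  ∷ block 1 7 14 37
  ∷ block 3 14 56 80
  ∷ block 14 25 33 45
  ∷ block 14 39 55 81
  ∷ block 14 41 50 85
  ∷ block 14 47 63 74
  ∷ block 14 49 61 73
  ∷ block 5 14 51 83
  ∷ block 9 14 62 67
  ∷ block 11 14 53 87
  ∷ block 13 14 58 66
  ∷ block 14 17 57 71
  ∷ block 14 21 60 68
  ∷ block 14 23 59 72
  ∷ block 14 31 52 65
  ∷ block 14 35 54 86
  ∷ block 16 18 31 74
  ∷ block 1 16 54 67
  ∷ block 3 9 16 39
  ∷ block 16 25 56 85
  ∷ block 16 35 37 47
  ∷ block 16 41 55 86
  ∷ block 16 43 50 66
  ∷ block 16 49 63 79
  ∷ block 5 16 61 78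
  ∷ block 7 16 51 88
  ∷ block 11 16 62 72
  ∷ block 13 16 53 68
  ∷ block 15 16 58 71
  ∷ block 16 19 57 76
  ∷ block 16 23 60 73
  ∷ block 16 27 59 77
  ∷ block 16 33 52 70
  ∷ block 18 20 33 79
  ∷ block 1 18 39 49
  ∷ block 3 18 54 72
  ∷ block 11 18 25 41
  ∷ block 18 37 56 66
  ∷ block 18 43 55 67
  ∷ block 18 45 50 71
  ∷ block 5 18 63 84
  ∷ block 7 18 61 83
  ∷ block 9 18 51 64
  ∷ block 13 18 62 77
  ∷ block 15 18 53 73
  ∷ block 17 18 58 76
  ∷ block 18 21 57 81
  ∷ block 18 27 60 78
  ∷ block 18 29 59 82
  ∷ block 18 35 52 75
  ∷ block 20 22 35 84
  ∷ block 1 20 52 80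
  ∷ block 3 5 20 41
  ∷ block 20 25 54 77
  ∷ block 13 20 37 43
  ∷ block 20 39 56 71
  ∷ block 20 45 55 72
  ∷ block 20 47 50 76
  ∷ block 7 20 63 65
  ∷ block 9 20 61 88
  ∷ block 11 20 51 69
  ∷ block 15 20 62 82
  ∷ block 17 20 53 78
  ∷ block 19 20 58 81
  ∷ block 20 23 57 86
  ∷ block 20 29 60 83
  ∷ block 20 31 59 87
  ∷ block 1 22 26 65
  ∷ block 3 22 52 85
  ∷ block 7 22 25 43
  ∷ block 22 37 54 82
  ∷ block 15 22 39 45
  ∷ block 22 41 56 76
  ∷ block 22 47 55 77
  ∷ block 22 49 50 81
  ∷ block 9 22 63 70
  ∷ block 11 22 61 64
  ∷ block 13 22 51 74
  ∷ block 17 22 62 87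
  ∷ block 19 22 53 83
  ∷ block 21 22 58 86
  ∷ block 22 27 57 67
  ∷ block 22 31 60 88
  ∷ block 22 33 59 68
  ∷ block 3 26 28 70
  ∷ block 25 26 52 66
  ∷ block 9 26 37 45
  ∷ block 26 39 54 87
  ∷ block 17 26 41 47
  ∷ block 26 43 56 81
  ∷ block 26 49 55 82
  ∷ block 5 26 50 86
  ∷ block 11 26 63 75
  ∷ block 13 26 61 69
  ∷ block 15 26 51 79
  ∷ block 19 26 62 68
  ∷ block 21 26 53 88
  ∷ block 23 26 58 67
  ∷ block 26 29 57 72
  ∷ block 26 33 60 64
  ∷ block 26 35 59 73
  ∷ block 25 28 30 75
  ∷ block 1 28 59 78
  ∷ block 28 37 52 71
  ∷ block 11 28 39 47
  ∷ block 28 41 54 68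
  ∷ block 19 28 43 49
  ∷ block 28 45 56 86
  ∷ block 5 28 55 87
  ∷ block 7 28 50 67
  ∷ block 13 28 63 80
  ∷ block 15 28 61 74
  ∷ block 17 28 51 84
  ∷ block 21 28 62 73
  ∷ block 23 28 53 64
  ∷ block 27 28 58 72
  ∷ block 28 31 57 77
  ∷ block 28 35 60 69
  ∷ block 30 32 37 80
  ∷ block 1 30 60 74
  ∷ block 3 30 59 83
  ∷ block 30 39 52 76
  ∷ block 13 30 41 49
  ∷ block 30 43 54 73
  ∷ block 5 21 30 45
  ∷ block 30 47 56 67
  ∷ block 7 30 55 68
  ∷ block 9 30 50 72
  ∷ block 15 30 63 85
  ∷ block 17 30 61 79
  ∷ block 19 30 51 65
  ∷ block 23 30 62 78
  ∷ block 27 30 53 69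
  ∷ block 29 30 58 77
  ∷ block 30 33 57 82
  ∷ block 32 34 39 85
  ∷ block 3 32 60 79
  ∷ block 25 32 59 88
  ∷ block 32 41 52 81
  ∷ block 5 15 32 43
  ∷ block 32 45 54 78
  ∷ block 7 23 32 47
  ∷ block 32 49 56 72
  ∷ block 9 32 55 73
  ∷ block 11 32 50 77
  ∷ block 17 32 63 66
  ∷ block 19 32 61 84
  ∷ block 21 32 51 70
  ∷ block 27 32 62 83
  ∷ block 29 32 53 74
  ∷ block 31 32 58 82
  ∷ block 32 35 57 87
  ∷ block 1 34 57 68
  ∷ block 25 34 60 84
  ∷ block 34 37 59 64
  ∷ block 34 43 52 86
  ∷ block 7 17 34 45
  ∷ block 34 47 54 83
  ∷ block 9 27 34 49
  ∷ block 5 34 56 77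
  ∷ block 11 34 55 78
  ∷ block 13 34 50 82
  ∷ block 19 34 63 71
  ∷ block 21 34 61 65
  ∷ block 23 34 51 75
  ∷ block 29 34 62 88
  ∷ block 31 34 53 79
  ∷ block 33 34 58 87
  ∷ block 1 3 45 82
  ∷ block 1 9 25 69
  ∷ block 1 35 43 77
  ∷ block 1 5 33 88
  ∷ block 1 11 15 86
  ∷ block 1 21 23 71
  ∷ block 1 66 72 83
  ∷ block 3 25 47 87
  ∷ block 3 11 37 74
  ∷ block 3 7 35 64
  ∷ block 3 13 17 67
  ∷ block 3 23 27 76
  ∷ block 3 71 77 88
  ∷ block 25 37 49 68
  ∷ block 13 25 39 79
  ∷ block 15 19 25 72
  ∷ block 25 27 29 81
  ∷ block 25 64 76 82
  ∷ block 5 37 39 73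
  ∷ block 15 37 41 84
  ∷ block 17 21 37 77
  ∷ block 29 31 37 86
  ∷ block 37 69 81 87
  ∷ block 7 39 41 78
  ∷ block 17 39 43 65
  ∷ block 19 23 39 82
  ∷ block 31 33 39 67
  ∷ block 39 68 74 86
  ∷ block 9 41 43 83
  ∷ block 19 41 45 70
  ∷ block 21 27 41 87
  ∷ block 33 35 41 72
  ∷ block 41 67 73 79
  ∷ block 11 43 45 88
  ∷ block 21 43 47 75
  ∷ block 23 29 43 68
  ∷ block 43 72 78 84
  ∷ block 13 45 47 64
  ∷ block 23 45 49 80
  ∷ block 27 31 45 73
  ∷ block 45 65 77 83
  ∷ block 15 47 49 69
  ∷ block 5 27 47 85
  ∷ block 29 33 47 78
  ∷ block 47 70 82 88
  ∷ block 5 17 49 74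
  ∷ block 7 29 49 66
  ∷ block 31 35 49 83
  ∷ block 49 64 75 87
  ∷ block 5 7 19 79
  ∷ block 5 9 31 71
  ∷ block 5 68 69 80
  ∷ block 7 9 21 84
  ∷ block 7 11 33 76
  ∷ block 7 73 74 85
  ∷ block 9 11 23 65
  ∷ block 9 13 35 81
  ∷ block 9 66 78 79
  ∷ block 11 13 27 70
  ∷ block 11 71 83 84
  ∷ block 13 15 29 75
  ∷ block 13 65 76 88
  ∷ block 15 17 31 80
  ∷ block 15 64 70 81
  ∷ block 17 19 33 85
  ∷ block 17 69 75 86
  ∷ block 19 21 35 66
  ∷ block 19 67 74 80
  ∷ block 21 72 79 85
  ∷ block 23 66 77 84
  ∷ block 27 65 71 82
  ∷ block 29 70 76 87
  ∷ block 31 68 75 81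
  ∷ block 33 73 80 86
  ∷ block 35 67 78 85
  ∷ block 64 69 83 85
  ∷ block 64 71 74 79
  ∷ block 64 78 80 88
  ∷ block 64 72 77 86
  ∷ block 66 69 74 88
  ∷ block 69 76 79 84
  ∷ block 67 69 77 82
  ∷ block 65 74 81 84
  ∷ block 72 74 82 87
  ∷ block 65 70 79 86
  ∷ block 68 77 79 87
  ∷ block 67 70 75 84
  ∷ block 68 73 82 84
  ∷ block 65 72 75 80
  ∷ block 65 73 78 87
  ∷ block 70 77 80 85
  ∷ block 68 70 78 83
  ∷ block 66 75 82 85
  ∷ block 73 75 83 88
  ∷ block 66 71 80 87
  ∷ block 68 71 76 85
  ∷ block 66 73 76 81
  ∷ block 71 78 81 86
  ∷ block 67 76 83 86
  ∷ block 67 72 81 88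
  ∷ block 50 52 59 62
  ∷ block 50 53 57 61
  ∷ block 50 54 56 63
  ∷ block 50 55 58 60
  ∷ block 51 52 56 60
  ∷ block 51 53 58 63
  ∷ block 51 54 59 61
  ∷ block 51 55 57 62
  ∷ block 52 54 57 58
  ∷ block 52 55 61 63
  ∷ block 53 54 60 62
  ∷ block 53 55 56 59
  ∷ block 56 58 61 62
  ∷ block 57 59 60 63
  ∷ []

gdd-2³²5⁵ : GDD4 _ (type25 32 5)
gdd-2³²5⁵ = Certifyᴺ.gdd4 32 5 89 (standardGroup 32) blocks-2³²5⁵ _ _ _

lemma4p7 : GDD4 _ (type25 21 4) × GDD4 _ (type25 24 4) × GDD4 _ (type25 27 4) × GDD4 _ (type25 33 4) × GDD4 _ (type25 32 5) × GDD4 _ (type25 35 5)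
lemma4p7 = gdd-2²¹5⁴ , gdd-2²⁴5⁴ , gdd-2²⁷5⁴ , gdd-2³³5⁴ , gdd-2³²5⁵ , gdd-2³⁵5⁵
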